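{- Let $T$ be a tree with $m$ edges and bipartition $(A,B)$. Let $m'_1,\ldots,m'_a$ be the degrees of the non-leaf vertices in $A$ and $m_1,\ldots,m_b$ the degrees of the non-leaf vertices in $B$. Then at least one of the following holds: (i) $m-\sum_{1\le i\le a}m'_i\ge \max_{1\le i\le a}m'_i-1$; (ii) $m-\sum_{1\le i\le b}m_i\ge\max_{1\le i\le b}m_i-1$.
   Context: A leaf is a vertex of degree 1. An empty sum is $0$ and a maximum over an empty index set is taken to be $0$. -}

module Defs where

open import Data.Bool using (Bool; true; false; T; not)
open import Data.Nat using (ℕ; zero; suc; _+_; _≤_; _⊔_)
open import Data.Fin using (Fin; _<_)
open import Data.List using (List; []; _∷_; length; filterᵇ; map; foldr; allFin; last; head)
open import Data.Nat.ListAction using (sum)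
open import Data.List.Relation.Unary.Unique.Propositional using (Unique)
open import Data.List.Relation.Unary.Linked using (Linked)
open import Data.Maybe using (Maybe; just; nothing)
open import Data.Product using (Σ; _×_; _,_)
open import Relation.Binary.PropositionalEquality using (_≡_)
open import Relation.Nullary using (¬_)
open import Data.Fin using (_<?_)
open import Relation.Nullary.Decidable using (⌊_⌋)

record Graph (n : ℕ) : Set where
  field
    adj   : Fin n → Fin n → Bool
    sym   : ∀ i j → adj i j ≡ adj j i
    irref : ∀ i → adj i i ≡ false
open Graph public

Adj : ∀ {n} → Graph n → Fin n → Fin n → Set
Adj G i j = T (adj G i j)

degree : ∀ {n} → Graph n → Fin n → ℕ
degree {n} G i = length (filterᵇ (adj G i) (allFin n))

edgeCount : ∀ {n} → Graph n → ℕ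
edgeCount {n} G =
  sum (map (λ i → length (filterᵇ (λ j → Data.Bool._∧_ ⌊ i <? j ⌋ (adj G i j)) (allFin n))) (allFin n))
  where import Data.Bool

data Walk {n : ℕ} (G : Graph n) : Fin n → Fin n → Set where
  here : ∀ {u} → Walk G u u
  step : ∀ {u w v} → Adj G u w → Walk G w v → Walk G u v

Connected : ∀ {n} → Graph n → Set
Connected {n} G = ∀ (u v : Fin n) → Walk G u v

record Cycle {n : ℕ} (G : Graph n) : Set where
  field
    verts    : List (Fin n)
    long     : 3 ≤ length verts
    distinct : Unique verts
    linked   : Linked (Adj G) verts
    closes   : ∀ {a b} → head verts ≡ just a → last verts ≡ just b → Adj G b a

Acyclic : ∀ {n} → Graph n → Set
Acyclic G = ¬ Cycle G

IsTree : ∀ {n} → Graph n → Set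
IsTree {n} G = (1 ≤ n) × Connected G × Acyclic G

-- (A, B) bipartition given by a colouring: A = colour true, B = colour false;
-- every edge joins the two sides
IsBipartition : ∀ {n} → Graph n → (Fin n → Bool) → Set
IsBipartition G c = ∀ i j → Adj G i j → c i ≡ not (c j)

isLeafᵇ : ∀ {n} → Graph n → Fin n → Bool
isLeafᵇ G i with degree G i
... | 1 = true
... | _ = false

nonLeafDegrees : ∀ {n} → Graph n → (Fin n → Bool) → Bool → List ℕ
nonLeafDegrees {n} G c b =
  map (degree G)
      (filterᵇ (λ i → Data.Bool._∧_ (not (isLeafᵇ G i)) (eqB (c i) b)) (allFin n))
  where
  import Data.Bool
  eqB : Bool → Bool → Bool
  eqB true true = true
  eqB false false = true
  eqB _ _ = false

-- maximum of a list, with max over empty = 0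
maxList : List ℕ → ℕ
maxList = foldr _⊔_ 0

-- Let m be the number of edges and, for a side b of the bipartition, let S_b, N_b and M_b be the sum,
-- number and maximum of its non-leaf degrees and L_b its number of leaves. Every edge has exactly one
-- endpoint on side b and leaves have degree 1, so S_b + L_b = m, and the claim is M_b ≤ L_b + 1 for some b.
-- Unless T is a single vertex every non-leaf has degree at least 2, so M_b + 2 (N_b - 1) ≤ S_b. A side
-- with M_b ≥ L_b + 2 therefore has at most m / 2 vertices, and if both sides failed we would get n ≤ m.
-- But m ≤ n - 1 in any forest: growing a path until it gets stuck yields a vertex of degree at most 1,
-- whose deletion removes at most one edge.
module Submission where

open import Defs hiding (sym)
open import Data.Bool using (Bool; true; false; T; not; _∧_)
open import Data.Bool.Properties using (T?)
open import Data.Empty using (⊥; ⊥-elim)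
open import Data.Fin using (Fin; _<?_)
import Data.Fin.Properties as Fin
open import Data.List using (List; []; _∷_; _++_; length; map; filterᵇ; allFin; last)
open import Data.List.Properties using (map-cong; length-map; length-tabulate)
open import Data.List.Membership.Propositional using (_∈_; _∉_)
open import Data.List.Membership.Propositional.Properties using (∈-∃++; ∈-allFin)
open import Data.List.Relation.Unary.All as All using (All; []; _∷_)
open import Data.List.Relation.Unary.All.Properties using (¬Any⇒All¬; all-filter; map⁺; ++⁺; ++⁻ˡ; ++⁻ʳ)
open import Data.List.Relation.Unary.Any using (here; there)
open import Data.List.Relation.Unary.Linked using (Linked; []; [-]; _∷_)
open import Data.List.Relation.Unary.Unique.Propositional using (Unique; []; _∷_)
open import Data.List.Relation.Unary.Unique.Propositional.Properties using (allFin⁺)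
open import Data.Maybe using (just)
open import Data.Nat using (ℕ; zero; suc; _+_; _*_; _≤_; _<_; z≤n; s≤s; _≤?_; _⊔_; z<s)
open import Data.Nat.ListAction using (sum)
open import Data.Nat.Tactic.RingSolver using (solve-∀)
open import Data.Nat.Properties hiding (_<?_)
open import Algebra.Properties.CommutativeSemigroup +-commutativeSemigroup
  using (interchange; x∙yz≈y∙xz)
open import Data.Product using (∃-syntax; _×_; _,_)
open import Data.Sum as Sum using (_⊎_; inj₁; inj₂)
open import Function using (_∘_; id)
open import Relation.Binary.PropositionalEquality
open import Relation.Binary.Definitions using (tri<; tri≈; tri>)
open import Relation.Nullary using (¬_; yes; no)
open import Relation.Nullary.Decidable using (⌊_⌋)

⟦_⟧ : Bool → ℕ
⟦ true ⟧ = 1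
⟦ false ⟧ = 0

module _ {A : Set} where

  ∑ : List A → (A → ℕ) → ℕ
  ∑ xs f = sum (map f xs)

  syntax ∑ xs (λ x → e) = ∑[ x ← xs ] e

  ∑-cong : ∀ {f g : A → ℕ} xs → (∀ x → f x ≡ g x) → ∑ xs f ≡ ∑ xs g
  ∑-cong xs f≗g = cong sum (map-cong f≗g xs)

  ∑-distrib-+ : ∀ (f g : A → ℕ) xs → ∑[ x ← xs ] (f x + g x) ≡ ∑ xs f + ∑ xs g
  ∑-distrib-+ f g [] = refl
  ∑-distrib-+ f g (x ∷ xs) =
    trans (cong (f x + g x +_) (∑-distrib-+ f g xs)) (interchange (f x) (g x) _ _)

  *-distribˡ-∑ : ∀ k (f : A → ℕ) xs → k * ∑ xs f ≡ ∑[ x ← xs ] (k * f x)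
  *-distribˡ-∑ k f [] = *-zeroʳ k
  *-distribˡ-∑ k f (x ∷ xs) =
    trans (*-distribˡ-+ k (f x) (∑ xs f)) (cong (k * f x +_) (*-distribˡ-∑ k f xs))

  ∑-zero : ∀ xs → ∑[ x ← xs ] 0 ≡ 0
  ∑-zero [] = refl
  ∑-zero (x ∷ xs) = ∑-zero xs

  ∑-++-∷ : ∀ (f : A → ℕ) xs {y zs} → ∑ (xs ++ y ∷ zs) f ≡ f y + ∑ (xs ++ zs) f
  ∑-++-∷ f [] = refl
  ∑-++-∷ f (x ∷ xs) {y} {zs} = trans (cong (f x +_) (∑-++-∷ f xs)) (x∙yz≈y∙xz (f x) (f y) (∑ (xs ++ zs) f))

  length-filterᵇ : ∀ (p : A → Bool) xs → length (filterᵇ p xs) ≡ ∑[ x ← xs ] ⟦ p x ⟧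
  length-filterᵇ p [] = refl
  length-filterᵇ p (x ∷ xs) with p x
  ... | true = cong suc (length-filterᵇ p xs)
  ... | false = length-filterᵇ p xs

  ∑-filterᵇ : ∀ (f : A → ℕ) (p : A → Bool) xs → ∑ (filterᵇ p xs) f ≡ ∑[ x ← xs ] (⟦ p x ⟧ * f x)
  ∑-filterᵇ f p [] = refl
  ∑-filterᵇ f p (x ∷ xs) with p x
  ... | true = cong₂ _+_ (sym (*-identityˡ (f x))) (∑-filterᵇ f p xs)
  ... | false = ∑-filterᵇ f p xs

  length≡∑1 : ∀ (xs : List A) → length xs ≡ ∑[ x ← xs ] 1
  length≡∑1 [] = refl
  length≡∑1 (x ∷ xs) = cong suc (length≡∑1 xs)

∑∑-distrib-+ : ∀ {A B : Set} (f g : A → B → ℕ) xs ys →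
               ∑[ x ← xs ] ∑[ y ← ys ] (f x y + g x y) ≡
               ∑[ x ← xs ] ∑[ y ← ys ] f x y + ∑[ x ← xs ] ∑[ y ← ys ] g x y
∑∑-distrib-+ f g xs ys = trans (∑-cong xs (λ x → ∑-distrib-+ (f x) (g x) ys)) (∑-distrib-+ _ _ xs)

∑-comm : ∀ {A B : Set} (f : A → B → ℕ) xs ys →
         ∑[ x ← xs ] ∑[ y ← ys ] f x y ≡ ∑[ y ← ys ] ∑[ x ← xs ] f x y
∑-comm f [] ys = sym (∑-zero ys)
∑-comm f (x ∷ xs) ys =
  trans (cong (∑ ys (f x) +_) (∑-comm f xs ys)) (sym (∑-distrib-+ (f x) _ ys))

module _ {A : Set} where

  length-++-∷ : ∀ (xs : List A) {y zs} → length (xs ++ y ∷ zs) ≡ suc (length (xs ++ zs))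
  length-++-∷ [] = refl
  length-++-∷ (x ∷ xs) = cong suc (length-++-∷ xs)

  ∈-++-∷⁻ : ∀ xs {x y : A} {zs} → y ∈ xs ++ x ∷ zs → y ≢ x → y ∈ xs ++ zs
  ∈-++-∷⁻ [] (here refl) y≢x = ⊥-elim (y≢x refl)
  ∈-++-∷⁻ [] (there y∈zs) _ = y∈zs
  ∈-++-∷⁻ (w ∷ xs) (here refl) _ = here refl
  ∈-++-∷⁻ (w ∷ xs) (there y∈) y≢x = there (∈-++-∷⁻ xs y∈ y≢x)

  Unique-++⁻ˡ : ∀ xs {ys : List A} → Unique (xs ++ ys) → Unique xs
  Unique-++⁻ˡ [] _ = []
  Unique-++⁻ˡ (x ∷ xs) (x∉ ∷ u) = ++⁻ˡ xs x∉ ∷ Unique-++⁻ˡ xs u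

  Unique-++-∷⁻ : ∀ xs {y : A} {zs} → Unique (xs ++ y ∷ zs) → Unique (xs ++ zs)
  Unique-++-∷⁻ [] (_ ∷ u) = u
  Unique-++-∷⁻ (x ∷ xs) (x∉ ∷ u) = ++⁺ (++⁻ˡ xs x∉) (All.tail (++⁻ʳ xs x∉)) ∷ Unique-++-∷⁻ xs u

  Unique-++-∷⇒∉ : ∀ xs {y : A} {zs} → Unique (xs ++ y ∷ zs) → y ∉ xs
  Unique-++-∷⇒∉ (x ∷ xs) (x∉ ∷ _) (here refl) = All.head (++⁻ʳ xs x∉) refl
  Unique-++-∷⇒∉ (x ∷ xs) (_ ∷ u) (there y∈xs) = Unique-++-∷⇒∉ xs u y∈xs

  Unique⊆⇒length≤ : ∀ {xs ys : List A} → Unique xs → (∀ {x} → x ∈ xs → x ∈ ys) → length xs ≤ length ys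
  Unique⊆⇒length≤ {[]} _ _ = z≤n
  Unique⊆⇒length≤ {x ∷ xs} (x∉xs ∷ u) xs⊆ys with ∈-∃++ (xs⊆ys (here refl))
  ... | P , Q , refl = subst (suc (length xs) ≤_) (sym (length-++-∷ P))
    (s≤s (Unique⊆⇒length≤ u λ y∈xs →
      ∈-++-∷⁻ P (xs⊆ys (there y∈xs)) (λ y≡x → All.lookup x∉xs y∈xs (sym y≡x))))

  Linked-++⁻ˡ : ∀ {R : A → A → Set} xs {ys} → Linked R (xs ++ ys) → Linked R xs
  Linked-++⁻ˡ [] _ = []
  Linked-++⁻ˡ (x ∷ []) _ = [-]
  Linked-++⁻ˡ (x ∷ x′ ∷ xs) (r ∷ l) = r ∷ Linked-++⁻ˡ (x′ ∷ xs) l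

  Linked-last : ∀ {R : A → A → Set} xs {y zs b} → Linked R (xs ++ y ∷ zs) → last xs ≡ just b → R b y
  Linked-last (x ∷ []) (r ∷ _) refl = r
  Linked-last (x ∷ x′ ∷ xs) (_ ∷ l) eq = Linked-last (x′ ∷ xs) l eq

module _ {n : ℕ} (G : Graph n) where

  Adj-sym : ∀ {x y} → Adj G x y → Adj G y x
  Adj-sym {x} {y} = subst T (Graph.sym G x y)

  Adj-irrefl : ∀ {x} → ¬ Adj G x x
  Adj-irrefl {x} a = subst T (irref G x) a

  adj⇒Adj : ∀ {x y} → adj G x y ≡ true → Adj G x y
  adj⇒Adj eq = subst T (sym eq) _

  IsPath : List (Fin n) → Set
  IsPath ps = Unique ps × Linked (Adj G) ps

  degreeIn : Fin n → List (Fin n) → ℕ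
  degreeIn x S = length (filterᵇ (adj G x) S)

  someNeighbour : ∀ x S → 1 ≤ degreeIn x S → ∃[ y ] y ∈ S × Adj G x y
  someNeighbour x (s ∷ S) d≥1 with adj G x s in eq
  ... | true = s , here refl , adj⇒Adj eq
  ... | false with someNeighbour x S d≥1
  ...   | y , y∈S , a = y , there y∈S , a

  neighbourOtherThan : ∀ x S q → Unique S → 2 ≤ degreeIn x S → ∃[ y ] y ∈ S × Adj G x y × y ≢ q
  neighbourOtherThan x (s ∷ S) q (s∉S ∷ uS) d≥2 with adj G x s in eq
  ... | false with neighbourOtherThan x S q uS d≥2
  ...   | y , y∈S , a , y≢q = y , there y∈S , a , y≢q
  neighbourOtherThan x (s ∷ S) q (s∉S ∷ uS) (s≤s d≥1) | true with s Fin.≟ q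
  ...   | no s≢q = s , here refl , adj⇒Adj eq , s≢q
  ...   | yes refl with someNeighbour x S d≥1
  ...     | y , y∈S , a = y , there y∈S , a , λ { refl → All.lookup s∉S y∈S refl }

  degreeIn-++-∷ : ∀ x P {y Q} → degreeIn x (P ++ y ∷ Q) ≡ ⟦ adj G x y ⟧ + degreeIn x (P ++ Q)
  degreeIn-++-∷ x P {y} {Q} = begin
    degreeIn x (P ++ y ∷ Q)                        ≡⟨ length-filterᵇ (adj G x) (P ++ y ∷ Q) ⟩
    ∑[ z ← P ++ y ∷ Q ] ⟦ adj G x z ⟧              ≡⟨ ∑-++-∷ (⟦_⟧ ∘ adj G x) P ⟩
    ⟦ adj G x y ⟧ + ∑[ z ← P ++ Q ] ⟦ adj G x z ⟧  ≡⟨ cong (⟦ adj G x y ⟧ +_) (length-filterᵇ (adj G x) (P ++ Q)) ⟨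
    ⟦ adj G x y ⟧ + degreeIn x (P ++ Q)            ∎
    where open ≡-Reasoning

  degreeIn-++-∷-self : ∀ x P {Q} → degreeIn x (P ++ x ∷ Q) ≡ degreeIn x (P ++ Q)
  degreeIn-++-∷-self x P {Q} = trans (degreeIn-++-∷ x P) (cong (λ b → ⟦ b ⟧ + degreeIn x (P ++ Q)) (irref G x))

  degreeSumIn : List (Fin n) → ℕ
  degreeSumIn S = ∑[ x ← S ] degreeIn x S

  degreeSumIn-++-∷ : ∀ P x Q →
    degreeSumIn (P ++ x ∷ Q) ≡ degreeIn x (P ++ Q) + (degreeIn x (P ++ Q) + degreeSumIn (P ++ Q))
  degreeSumIn-++-∷ P x Q = begin
    ∑[ z ← P ++ x ∷ Q ] degreeIn z (P ++ x ∷ Q)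
      ≡⟨ ∑-++-∷ (λ z → degreeIn z (P ++ x ∷ Q)) P ⟩
    degreeIn x (P ++ x ∷ Q) + ∑[ z ← R ] degreeIn z (P ++ x ∷ Q)
      ≡⟨ cong₂ _+_ (degreeIn-++-∷-self x P) (∑-cong R (λ z → degreeIn-++-∷ z P)) ⟩
    degreeIn x R + ∑[ z ← R ] (⟦ adj G z x ⟧ + degreeIn z R)
      ≡⟨ cong (degreeIn x R +_) (∑-distrib-+ (λ z → ⟦ adj G z x ⟧) (λ z → degreeIn z R) R) ⟩
    degreeIn x R + (∑[ z ← R ] ⟦ adj G z x ⟧ + degreeSumIn R)
      ≡⟨ cong (λ d → degreeIn x R + (d + degreeSumIn R)) x-row ⟩
    degreeIn x R + (degreeIn x R + degreeSumIn R) ∎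
    where
    open ≡-Reasoning
    R : List (Fin n)
    R = P ++ Q
    x-row : ∑[ z ← R ] ⟦ adj G z x ⟧ ≡ degreeIn x R
    x-row = trans (∑-cong R (λ z → cong ⟦_⟧ (Graph.sym G z x))) (sym (length-filterᵇ (adj G x) R))

  isLeafᵇ⇒degree≡1 : ∀ i → isLeafᵇ G i ≡ true → degree G i ≡ 1
  isLeafᵇ⇒degree≡1 i _ with degree G i
  isLeafᵇ⇒degree≡1 i _  | 1 = refl
  isLeafᵇ⇒degree≡1 i () | zero
  isLeafᵇ⇒degree≡1 i () | suc (suc _)

  ¬isLeafᵇ⇒degree≢1 : ∀ i → isLeafᵇ G i ≡ false → degree G i ≢ 1
  ¬isLeafᵇ⇒degree≢1 i _ _ with degree G i
  ¬isLeafᵇ⇒degree≢1 i () refl | 1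

  Adj⇒0<degreeIn : ∀ {x y} S → Adj G x y → y ∈ S → 0 < degreeIn x S
  Adj⇒0<degreeIn {x} (s ∷ S) a y∈ with adj G x s in eq
  ... | true = z<s
  Adj⇒0<degreeIn {x} (s ∷ S) a (here refl) | false = ⊥-elim (subst T eq a)
  Adj⇒0<degreeIn {x} (s ∷ S) a (there y∈S) | false = Adj⇒0<degreeIn S a y∈S

  isolated⇒edgeless : Connected G → ∀ {w} → degree G w ≡ 0 → ∀ i → degree G i ≡ 0
  isolated⇒edgeless conn {w} w-isolated i with conn w i
  ... | here = w-isolated
  ... | step {w = v} a _ =
    ⊥-elim (<⇒≢ (subst (0 <_) w-isolated (Adj⇒0<degreeIn (allFin n) a (∈-allFin v))) refl)

  module _ (acyclic : Acyclic G) where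

    noChord : ∀ {x q r y} → IsPath (x ∷ q ∷ r) → y ∈ r → ¬ Adj G x y
    noChord {x} {q} {y = y} (u , l) y∈r a with ∈-∃++ y∈r
    ... | ys , zs , refl = acyclic record
      { verts    = y ∷ x ∷ q ∷ ys
      ; long     = s≤s (s≤s (s≤s z≤n))
      ; distinct = ¬Any⇒All¬ _ (Unique-++-∷⇒∉ (x ∷ q ∷ ys) u) ∷ Unique-++⁻ˡ (x ∷ q ∷ ys) u
      ; linked   = Adj-sym a ∷ Linked-++⁻ˡ (x ∷ q ∷ ys) l
      ; closes   = λ { refl → Linked-last (x ∷ q ∷ ys) l }
      }

    freshNeighbour : ∀ {x rest S} → IsPath (x ∷ rest) → Unique S → 2 ≤ degreeIn x S →
                     ∃[ y ] y ∈ S × Adj G x y × y ∉ x ∷ rest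
    freshNeighbour {x} {[]} {S} _ uS d≥2 with neighbourOtherThan x S x uS d≥2
    ... | y , y∈S , a , y≢x = y , y∈S , a , λ { (here y≡x) → y≢x y≡x }
    freshNeighbour {x} {q ∷ r} {S} path uS d≥2 with neighbourOtherThan x S q uS d≥2
    ... | y , y∈S , a , y≢q = y , y∈S , a , λ
      { (here refl)         → Adj-irrefl a
      ; (there (here y≡q))  → y≢q y≡q
      ; (there (there y∈r)) → noChord path y∈r a
      }

    -- Extend the path at its head while the head has two neighbours in S; acyclicity keeps the path
    -- simple, so it stays no longer than S and the fuel k cannot run out.
    lowDegreeVertexFrom : ∀ S → Unique S → ∀ k x rest → IsPath (x ∷ rest) → All (_∈ S) (x ∷ rest) →
                          length S < k + length (x ∷ rest) → ∃[ y ] y ∈ S × degreeIn y S ≤ 1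
    lowDegreeVertexFrom S uS zero x rest (u , _) ⊆S S<path =
      ⊥-elim (<⇒≱ S<path (Unique⊆⇒length≤ u (All.lookup ⊆S)))
    lowDegreeVertexFrom S uS (suc k) x rest (u , l) ⊆S S<k+path with degreeIn x S ≤? 1
    ... | yes d≤1 = x , All.head ⊆S , d≤1
    ... | no d≰1 with freshNeighbour (u , l) uS (≰⇒> d≰1)
    ...   | y , y∈S , a , y∉ = lowDegreeVertexFrom S uS k y (x ∷ rest)
              (¬Any⇒All¬ _ y∉ ∷ u , Adj-sym a ∷ l) (y∈S ∷ ⊆S)
              (subst (length S <_) (sym (+-suc k (length (x ∷ rest)))) S<k+path)

    lowDegreeVertex : ∀ S → Unique S → 0 < length S → ∃[ y ] y ∈ S × degreeIn y S ≤ 1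
    lowDegreeVertex S@(s ∷ _) uS _ =
      lowDegreeVertexFrom S uS (length S) s [] ([] ∷ [] , [-]) (here refl ∷ []) (m<m+n (length S) z<s)

    degreeSumIn≤ : ∀ k S → Unique S → length S ≡ suc k → degreeSumIn S ≤ k + k
    degreeSumIn≤ zero (x ∷ []) _ _ rewrite irref G x = z≤n
    degreeSumIn≤ (suc k) S uS |S|≡ with lowDegreeVertex S uS (subst (0 <_) (sym |S|≡) z<s)
    ... | x , x∈S , d≤1 with ∈-∃++ x∈S
    ...   | P , Q , refl = begin
      degreeSumIn (P ++ x ∷ Q)                       ≡⟨ degreeSumIn-++-∷ P x Q ⟩
      degreeIn x R + (degreeIn x R + degreeSumIn R)  ≤⟨ +-mono-≤ d′≤1 (+-mono-≤ d′≤1 R-bound) ⟩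
      suc (suc (k + k))                              ≡⟨ cong suc (+-suc k k) ⟨
      suc k + suc k                                  ∎
      where
      open ≤-Reasoning
      R : List (Fin n)
      R = P ++ Q
      d′≤1 : degreeIn x R ≤ 1
      d′≤1 = subst (_≤ 1) (degreeIn-++-∷-self x P) d≤1
      R-bound : degreeSumIn R ≤ k + k
      R-bound = degreeSumIn≤ k R (Unique-++-∷⁻ P uS) (suc-injective (trans (sym (length-++-∷ P)) |S|≡))

module Sides {n : ℕ} (G : Graph n) (c : Fin n → Bool) where

  V : List (Fin n)
  V = allFin n

  onSide : Bool → Fin n → Bool
  onSide true i = c i
  onSide false i = not (c i)

  ⟦onSide⟧-partition : ∀ i → ⟦ onSide true i ⟧ + ⟦ onSide false i ⟧ ≡ 1
  ⟦onSide⟧-partition i with c i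
  ... | true = refl
  ... | false = refl

  edgeIndicator : Fin n → Fin n → ℕ
  edgeIndicator i j = ⟦ ⌊ i <? j ⌋ ∧ adj G i j ⟧

  edgeCount≡∑∑ : edgeCount G ≡ ∑[ i ← V ] ∑[ j ← V ] edgeIndicator i j
  edgeCount≡∑∑ = ∑-cong V (λ i → length-filterᵇ (λ j → ⌊ i <? j ⌋ ∧ adj G i j) V)

  ⟦adj⟧-split : ∀ i j → ⟦ adj G i j ⟧ ≡ edgeIndicator i j + edgeIndicator j i
  ⟦adj⟧-split i j with i <? j | j <? i
  ... | yes i<j | yes j<i = ⊥-elim (Fin.<-asym i<j j<i)
  ... | yes _   | no _    = sym (+-identityʳ _)
  ... | no _    | yes _   = cong ⟦_⟧ (Graph.sym G i j)
  ... | no i≮j  | no j≮i with Fin.<-cmp i j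
  ...   | tri< i<j _ _ = ⊥-elim (i≮j i<j)
  ...   | tri> _ _ j<i = ⊥-elim (j≮i j<i)
  ...   | tri≈ _ refl _ = cong ⟦_⟧ (irref G i)

  degree≡∑edgeIndicator : ∀ i → degree G i ≡ ∑[ j ← V ] (edgeIndicator i j + edgeIndicator j i)
  degree≡∑edgeIndicator i = trans (length-filterᵇ (adj G i) V) (∑-cong V (⟦adj⟧-split i))

  sideDegreeSum : Bool → ℕ
  sideDegreeSum b = ∑[ i ← V ] (⟦ onSide b i ⟧ * degree G i)

  degreeSum≡sideDegreeSums : ∑[ i ← V ] degree G i ≡ sideDegreeSum true + sideDegreeSum false
  degreeSum≡sideDegreeSums = trans (∑-cong V split) (∑-distrib-+ _ _ V)
    where
    split : ∀ i → degree G i ≡ ⟦ onSide true i ⟧ * degree G i + ⟦ onSide false i ⟧ * degree G i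
    split i = sym (begin
      ⟦ onSide true i ⟧ * d + ⟦ onSide false i ⟧ * d  ≡⟨ *-distribʳ-+ d ⟦ onSide true i ⟧ _ ⟨
      (⟦ onSide true i ⟧ + ⟦ onSide false i ⟧) * d    ≡⟨ cong (_* d) (⟦onSide⟧-partition i) ⟩
      1 * d                                            ≡⟨ *-identityˡ d ⟩
      d                                                ∎)
      where
      open ≡-Reasoning
      d : ℕ
      d = degree G i

  oneEndpointOnSide : ∀ b {i j} → c i ≡ not (c j) → ⟦ onSide b i ⟧ + ⟦ onSide b j ⟧ ≡ 1
  oneEndpointOnSide true {j = j} ci≡ rewrite ci≡ with c j
  ... | true  = refl
  ... | false = refl
  oneEndpointOnSide false {j = j} ci≡ rewrite ci≡ with c j
  ... | true  = refl
  ... | false = refl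

  module _ (bip : IsBipartition G c) where

    edgeIndicator-weight : ∀ b i j → (⟦ onSide b i ⟧ + ⟦ onSide b j ⟧) * edgeIndicator i j ≡ edgeIndicator i j
    edgeIndicator-weight b i j with ⌊ i <? j ⌋ | adj G i j in eq
    ... | false | _     = *-zeroʳ (⟦ onSide b i ⟧ + ⟦ onSide b j ⟧)
    ... | true  | false = *-zeroʳ (⟦ onSide b i ⟧ + ⟦ onSide b j ⟧)
    ... | true  | true  = cong (_* 1) (oneEndpointOnSide b (bip i j (adj⇒Adj G eq)))

    sideDegreeSum≡edgeCount : ∀ b → sideDegreeSum b ≡ edgeCount G
    sideDegreeSum≡edgeCount b = begin
      ∑[ i ← V ] (s i * degree G i)
        ≡⟨ ∑-cong V (λ i → trans (cong (s i *_) (degree≡∑edgeIndicator i)) (*-distribˡ-∑ (s i) _ V)) ⟩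
      ∑[ i ← V ] ∑[ j ← V ] (s i * (e i j + e j i))
        ≡⟨ ∑-cong V (λ i → ∑-cong V (λ j → *-distribˡ-+ (s i) (e i j) (e j i))) ⟩
      ∑[ i ← V ] ∑[ j ← V ] (s i * e i j + s i * e j i)
        ≡⟨ ∑∑-distrib-+ (λ i j → s i * e i j) (λ i j → s i * e j i) V V ⟩
      ∑[ i ← V ] ∑[ j ← V ] (s i * e i j) + ∑[ i ← V ] ∑[ j ← V ] (s i * e j i)
        ≡⟨ cong (∑[ i ← V ] ∑[ j ← V ] (s i * e i j) +_) (∑-comm (λ i j → s i * e j i) V V) ⟩
      ∑[ i ← V ] ∑[ j ← V ] (s i * e i j) + ∑[ i ← V ] ∑[ j ← V ] (s j * e i j)
        ≡⟨ ∑∑-distrib-+ (λ i j → s i * e i j) (λ i j → s j * e i j) V V ⟨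
      ∑[ i ← V ] ∑[ j ← V ] (s i * e i j + s j * e i j)
        ≡⟨ ∑-cong V (λ i → ∑-cong V (λ j →
             trans (sym (*-distribʳ-+ (e i j) (s i) (s j))) (edgeIndicator-weight b i j))) ⟩
      ∑[ i ← V ] ∑[ j ← V ] e i j
        ≡⟨ edgeCount≡∑∑ ⟨
      edgeCount G ∎
      where
      open ≡-Reasoning
      s : Fin n → ℕ
      s i = ⟦ onSide b i ⟧
      e : Fin n → Fin n → ℕ
      e = edgeIndicator

  -- `nonLeafDegrees` compares colours with a function local to its definition, so its filter
  -- predicate can only be named by reading it off the unfolded definition.
  filterPredicate : ∀ {p : Fin n → Bool} {ds : List ℕ} → map (degree G) (filterᵇ p V) ≡ ds → Fin n → Bool
  filterPredicate {p} _ = p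

  nonLeafOn : Bool → Fin n → Bool
  nonLeafOn b = filterPredicate (refl {x = nonLeafDegrees G c b})

  nonLeafOn-spec : ∀ b i → nonLeafOn b i ≡ not (isLeafᵇ G i) ∧ onSide b i
  nonLeafOn-spec true i with c i
  ... | true  = refl
  ... | false = refl
  nonLeafOn-spec false i with c i
  ... | true  = refl
  ... | false = refl

  leafOn : Bool → Fin n → Bool
  leafOn b i = isLeafᵇ G i ∧ onSide b i

  leafCount : Bool → ℕ
  leafCount b = ∑[ i ← V ] ⟦ leafOn b i ⟧

  sideSize : Bool → ℕ
  sideSize b = ∑[ i ← V ] ⟦ onSide b i ⟧

  sum-nonLeafDegrees+leafCount : ∀ b → sum (nonLeafDegrees G c b) + leafCount b ≡ sideDegreeSum b
  sum-nonLeafDegrees+leafCount b =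
    trans (cong (_+ leafCount b) (∑-filterᵇ (degree G) (nonLeafOn b) V))
          (trans (sym (∑-distrib-+ _ _ V)) (∑-cong V split))
    where
    split : ∀ i → ⟦ nonLeafOn b i ⟧ * degree G i + ⟦ leafOn b i ⟧ ≡ ⟦ onSide b i ⟧ * degree G i
    split i rewrite nonLeafOn-spec b i with isLeafᵇ G i in leaf | onSide b i
    ... | true  | true  = sym (trans (+-identityʳ (degree G i)) (isLeafᵇ⇒degree≡1 G i leaf))
    ... | true  | false = refl
    ... | false | true  = +-identityʳ _
    ... | false | false = refl

  length-nonLeafDegrees+leafCount : ∀ b → length (nonLeafDegrees G c b) + leafCount b ≡ sideSize b
  length-nonLeafDegrees+leafCount b =
    trans (cong (_+ leafCount b) (trans (length-map (degree G) (filterᵇ (nonLeafOn b) V))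
                                        (length-filterᵇ (nonLeafOn b) V)))
          (trans (sym (∑-distrib-+ _ _ V)) (∑-cong V split))
    where
    split : ∀ i → ⟦ nonLeafOn b i ⟧ + ⟦ leafOn b i ⟧ ≡ ⟦ onSide b i ⟧
    split i rewrite nonLeafOn-spec b i with isLeafᵇ G i | onSide b i
    ... | true  | true  = refl
    ... | true  | false = refl
    ... | false | true  = refl
    ... | false | false = refl

  sideSize-true+false : sideSize true + sideSize false ≡ n
  sideSize-true+false = begin
    sideSize true + sideSize false                       ≡⟨ ∑-distrib-+ (⟦_⟧ ∘ onSide true) (⟦_⟧ ∘ onSide false) V ⟨
    ∑[ i ← V ] (⟦ onSide true i ⟧ + ⟦ onSide false i ⟧) ≡⟨ ∑-cong V ⟦onSide⟧-partition ⟩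
    ∑[ i ← V ] 1                    ≡⟨ length≡∑1 V ⟨
    length V                        ≡⟨ length-tabulate id ⟩
    n                               ∎
    where open ≡-Reasoning

  nonLeafDegrees-All : ∀ b {P : ℕ → Set} → (∀ i → degree G i ≢ 1 → P (degree G i)) →
                       All P (nonLeafDegrees G c b)
  nonLeafDegrees-All b {P} nonLeaf⇒P = map⁺ (All.map (λ {i} → P-of i) (all-filter (T? ∘ nonLeafOn b) V))
    where
    P-of : ∀ i → T (nonLeafOn b i) → P (degree G i)
    P-of i t rewrite nonLeafOn-spec b i with isLeafᵇ G i in leaf
    ... | false = nonLeaf⇒P i (¬isLeafᵇ⇒degree≢1 G i leaf)
    ... | true  = ⊥-elim t

  sum-nonLeafDegrees+leafCount≡edgeCount : IsBipartition G c → ∀ b →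
                                           sum (nonLeafDegrees G c b) + leafCount b ≡ edgeCount G
  sum-nonLeafDegrees+leafCount≡edgeCount bip b =
    trans (sum-nonLeafDegrees+leafCount b) (sideDegreeSum≡edgeCount bip b)

edgeCount+edgeCount≤ : ∀ {k} (G : Graph (suc k)) (c : Fin (suc k) → Bool) → IsBipartition G c → Acyclic G →
                       edgeCount G + edgeCount G ≤ k + k
edgeCount+edgeCount≤ {k} G c bip acyclic =
  subst (_≤ k + k) degreeSum≡ (degreeSumIn≤ G acyclic k V (allFin⁺ (suc k)) (length-tabulate id))
  where
  open Sides G c
  degreeSum≡ : degreeSumIn G V ≡ edgeCount G + edgeCount G
  degreeSum≡ = trans degreeSum≡sideDegreeSums
                     (cong₂ _+_ (sideDegreeSum≡edgeCount bip true) (sideDegreeSum≡edgeCount bip false))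

maxList≤ : ∀ {k xs} → All (_≤ k) xs → maxList xs ≤ k
maxList≤ [] = z≤n
maxList≤ (x≤k ∷ xs≤k) = ⊔-lub x≤k (maxList≤ xs≤k)

length+length≤sum : ∀ xs → All (2 ≤_) xs → length xs + length xs ≤ sum xs
length+length≤sum [] [] = z≤n
length+length≤sum (x ∷ xs) (2≤x ∷ 2≤xs) =
  subst (_≤ x + sum xs) (cong suc (sym (+-suc (length xs) (length xs))))
        (+-mono-≤ 2≤x (length+length≤sum xs 2≤xs))

maxList+length+length≤sum+2 : ∀ xs → All (2 ≤_) xs → maxList xs + (length xs + length xs) ≤ sum xs + 2
maxList+length+length≤sum+2 [] [] = z≤n
maxList+length+length≤sum+2 (x ∷ xs) (2≤x ∷ 2≤xs) = begin
  x ⊔ M + (suc L + suc L)              ≡⟨ shuffle (x ⊔ M) L ⟩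
  x ⊔ M + (L + L) + 2                  ≡⟨ cong (_+ 2) (+-distribʳ-⊔ (L + L) x M) ⟩
  (x + (L + L)) ⊔ (M + (L + L)) + 2    ≤⟨ +-monoˡ-≤ 2 (⊔-lub x-bound M-bound) ⟩
  x + sum xs + 2                       ∎
  where
  open ≤-Reasoning
  M L : ℕ
  M = maxList xs
  L = length xs
  shuffle : ∀ a l → a + (suc l + suc l) ≡ a + (l + l) + 2
  shuffle = solve-∀
  x-bound : x + (L + L) ≤ x + sum xs
  x-bound = +-monoʳ-≤ x (length+length≤sum xs 2≤xs)
  M-bound : M + (L + L) ≤ x + sum xs
  M-bound = begin
    M + (L + L)  ≤⟨ maxList+length+length≤sum+2 xs 2≤xs ⟩
    sum xs + 2   ≤⟨ +-monoʳ-≤ (sum xs) 2≤x ⟩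
    sum xs + x   ≡⟨ +-comm (sum xs) x ⟩
    x + sum xs   ∎

sideDichotomy : ∀ ds L {m} → All (2 ≤_) ds → sum ds + L ≡ m →
                maxList ds ≤ 1 + L ⊎ (length ds + L) + (length ds + L) ≤ m
sideDichotomy ds L 2≤ds refl with maxList ds ≤? 1 + L
... | yes M≤1+L = inj₁ M≤1+L
... | no M≰1+L = inj₂ (begin
  (N + L) + (N + L)   ≡⟨ regroup N L ⟩
  L + (N + N) + L     ≤⟨ +-monoˡ-≤ L (+-cancelʳ-≤ 2 (L + (N + N)) S core) ⟩
  S + L               ∎)
  where
  open ≤-Reasoning
  N S : ℕ
  N = length ds
  S = sum ds
  regroup : ∀ n l → (n + l) + (n + l) ≡ l + (n + n) + l
  regroup = solve-∀
  core : L + (N + N) + 2 ≤ S + 2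
  core = begin
    L + (N + N) + 2      ≡⟨ +-comm (L + (N + N)) 2 ⟩
    2 + L + (N + N)      ≤⟨ +-monoˡ-≤ (N + N) (≰⇒> M≰1+L) ⟩
    maxList ds + (N + N) ≤⟨ maxList+length+length≤sum+2 ds 2≤ds ⟩
    S + 2                ∎

smallSides⇒⊥ : ∀ a b {m k} → a + a ≤ m → b + b ≤ m → a + b ≡ suc k → m + m ≤ k + k → ⊥
smallSides⇒⊥ a b {m} {k} a-small b-small sizes edges = <⇒≱ (begin-strict
  k + k              <⟨ +-mono-< (n<1+n k) (n<1+n k) ⟩
  suc k + suc k      ≡⟨ cong₂ _+_ sizes sizes ⟨
  (a + b) + (a + b)  ≡⟨ interchange a b a b ⟩
  (a + a) + (b + b)  ≤⟨ +-mono-≤ a-small b-small ⟩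
  m + m              ∎) edges
  where open ≤-Reasoning

oneSideBound : ∀ dt Lt df Lf {m k} →
  All (2 ≤_) dt → sum dt + Lt ≡ m → All (2 ≤_) df → sum df + Lf ≡ m →
  (length dt + Lt) + (length df + Lf) ≡ suc k → m + m ≤ k + k →
  maxList dt ≤ 1 + Lt ⊎ maxList df ≤ 1 + Lf
oneSideBound dt Lt df Lf 2≤dt et 2≤df ef sizes edges
  with sideDichotomy dt Lt 2≤dt et | sideDichotomy df Lf 2≤df ef
... | inj₁ ok      | _            = inj₁ ok
... | inj₂ _       | inj₁ ok      = inj₂ ok
... | inj₂ t-small | inj₂ f-small =
  ⊥-elim (smallSides⇒⊥ (length dt + Lt) (length df + Lf) t-small f-small sizes edges)

open import Data.Integer using (+_; _-_; _≥_; _⊖_)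
import Data.Integer.Properties as ℤ

sideBound-ℤ : ∀ S L {m M} → S + L ≡ m → M ≤ 1 + L → + m - + S ≥ + M - + 1
sideBound-ℤ S L {M = M} refl M≤1+L = begin
  + M - + 1          ≡⟨ ℤ.[+m]-[+n]≡m⊖n M 1 ⟩
  M ⊖ 1              ≤⟨ ℤ.⊖-monoˡ-≤ 1 M≤1+L ⟩
  suc L ⊖ 1          ≡⟨ ℤ.[1+m]⊖[1+n]≡m⊖n L 0 ⟩
  L ⊖ 0              ≡⟨ ℤ.+-cancelˡ-⊖ S L 0 ⟨
  (S + L) ⊖ (S + 0)  ≡⟨ cong ((S + L) ⊖_) (+-identityʳ S) ⟩
  (S + L) ⊖ S        ≡⟨ ℤ.[+m]-[+n]≡m⊖n (S + L) S ⟨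
  + (S + L) - + S    ∎
  where open ℤ.≤-Reasoning

mainTheorem4 : ∀ {n : ℕ} (T : Graph n) → IsTree T →
    (c : Fin n → Bool) → IsBipartition T c →
    ((+ edgeCount T) - (+ sum (nonLeafDegrees T c true))
        ≥ (+ maxList (nonLeafDegrees T c true)) - (+ 1))
    ⊎
    ((+ edgeCount T) - (+ sum (nonLeafDegrees T c false))
        ≥ (+ maxList (nonLeafDegrees T c false)) - (+ 1))
mainTheorem4 {zero} T (() , _) c bip
mainTheorem4 {suc k} T (_ , connected , acyclic) c bip = Sum.map (sideBound true) (sideBound false) someSide
  where
  open Sides T c
  handshake : ∀ b → sum (nonLeafDegrees T c b) + leafCount b ≡ edgeCount T
  handshake = sum-nonLeafDegrees+leafCount≡edgeCount bip
  sideBound : ∀ b → maxList (nonLeafDegrees T c b) ≤ 1 + leafCount b →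
              + edgeCount T - + sum (nonLeafDegrees T c b) ≥ + maxList (nonLeafDegrees T c b) - + 1
  sideBound b = sideBound-ℤ (sum (nonLeafDegrees T c b)) (leafCount b) (handshake b)
  someSide : maxList (nonLeafDegrees T c true) ≤ 1 + leafCount true ⊎
             maxList (nonLeafDegrees T c false) ≤ 1 + leafCount false
  someSide with Fin.any? (λ i → degree T i ≟ 0)
  ... | yes (w , w-isolated) = inj₁ (≤-trans (maxList≤ (nonLeafDegrees-All true λ i _ →
          ≤-reflexive (isolated⇒edgeless T connected w-isolated i))) z≤n)
  ... | no no-isolated =
    oneSideBound (nonLeafDegrees T c true) (leafCount true) (nonLeafDegrees T c false) (leafCount false)
                 (nonLeaf≥2 true) (handshake true) (nonLeaf≥2 false) (handshake false)
                 sizes (edgeCount+edgeCount≤ T c bip acyclic)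
    where
    nonLeaf≥2 : ∀ b → All (2 ≤_) (nonLeafDegrees T c b)
    nonLeaf≥2 b = nonLeafDegrees-All b λ i d≢1 →
      ≤∧≢⇒< (n≢0⇒n>0 (λ d≡0 → no-isolated (i , d≡0))) (d≢1 ∘ sym)
    sizes : (length (nonLeafDegrees T c true) + leafCount true) +
            (length (nonLeafDegrees T c false) + leafCount false) ≡ suc k
    sizes = trans (cong₂ _+_ (length-nonLeafDegrees+leafCount true) (length-nonLeafDegrees+leafCount false))
                  sideSize-true+false
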